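{- Let $p$ be an odd prime and let $G=\langle\sigma\rangle:\langle\tau\rangle\cong C_{p^m}:C_{p^n}$ with $m\ge n\ge 1$, where $\langle\sigma\rangle\cong C_{p^m}$ is normal in $G$, $\langle\tau\rangle\cong C_{p^n}$ and $\langle\sigma\rangle\cap\langle\tau\rangle=1$. If $g\in G$, $g\neq 1$, satisfies $\langle g\rangle\cap\langle\sigma\rangle=1$, then there exists $\tau'\in G$ such that $\langle\tau'\rangle\cong C_{p^n}$ and $g\in\langle\tau'\rangle$. -}

module Defs where

open import Level using (Level)
open import Algebra.Bundles using (Group)
open import Data.Nat using (ℕ; zero; suc; _<_)
open import Data.Integer using (ℤ; +_; -[1+_])
open import Data.Product using (Σ; _×_; ∃)
open import Relation.Nullary using (¬_)

module GroupDefs {c ℓ : Level} (G : Group c ℓ) where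
  open Group G

  _^ℕ_ : Carrier → ℕ → Carrier
  x ^ℕ zero = ε
  x ^ℕ suc k = x ∙ (x ^ℕ k)

  _^_ : Carrier → ℤ → Carrier
  x ^ (+ k) = x ^ℕ k
  x ^ -[1+ k ] = (x ^ℕ suc k) ⁻¹

  _∈⟨_⟩ : Carrier → Carrier → Set ℓ
  y ∈⟨ x ⟩ = ∃ λ (k : ℤ) → x ^ k ≈ y

  TrivialIntersection : Carrier → Carrier → Set (c Level.⊔ ℓ)
  TrivialIntersection x y = ∀ z → z ∈⟨ x ⟩ → z ∈⟨ y ⟩ → z ≈ ε

  -- x has order exactly k  (i.e. ⟨x⟩ ≅ C_k)
  HasOrder : Carrier → ℕ → Set ℓ
  HasOrder x k = (0 < k) × (x ^ℕ k ≈ ε) × (∀ j → 0 < j → j < k → ¬ (x ^ℕ j ≈ ε))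

  NormalCyclic : Carrier → Set (c Level.⊔ ℓ)
  NormalCyclic x = ∀ h → ((h ∙ x) ∙ (h ⁻¹)) ∈⟨ x ⟩

  Generates : Carrier → Carrier → Set (c Level.⊔ ℓ)
  Generates σ τ = ∀ g → ∃ λ (i : ℤ) → ∃ λ (j : ℤ) → g ≈ ((σ ^ i) ∙ (τ ^ j))

module Submission where

-- Conjugation by τ acts on ⟨σ⟩ as σ ↦ σ ^ r, and τ ^ (p ^ n) = 1 gives r ^ (p ^ n) ≡ 1 (mod p ^ m);
-- since a unit modulo p has some order e < p, and e is coprime to p ^ n, this forces r ≡ 1 (mod p).
-- Powers of σ ^ a τ are (σ ^ a τ) ^ N = σ ^ (a (1 + r + ⋯ + r ^ (N - 1))) τ ^ N, and for r ≡ 1 (mod p)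
-- and odd p the geometric sum 1 + r + ⋯ + r ^ (p ^ t - 1) is p ^ t times a unit modulo every power of p.
-- Write g = σ ^ i τ ^ j.  As ⟨g⟩ ∩ ⟨σ⟩ = 1 we have τ ^ j ≠ 1, so j = p ^ k u with p ∤ u and k < n;
-- choosing v with u v ≡ 1 (mod p ^ n) gives g ^ v = σ ^ i′ τ ^ (p ^ k).  Its p ^ (n - k)-th power lies
-- in ⟨g⟩ ∩ ⟨σ⟩, hence is 1, and this forces p ^ k ∣ i′.  So some a makes (σ ^ a τ) ^ (p ^ k) = g ^ v;
-- then τ′ = σ ^ a τ has order p ^ n (its powers below p ^ n have τ-part τ ^ J ∉ ⟨σ⟩), and
-- g = (g ^ v) ^ u lies in ⟨τ′⟩.

open import Defs
open import Level using (Level; 0ℓ)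
open import Algebra.Bundles using (Group)
open import Data.Nat
open import Data.Nat.Properties
open import Data.Nat.DivMod using (_%_; m%n<n; m%n%n≡m%n)
open import Data.Nat.Divisibility using (_∣_; divides; ∣-trans; m%n≡0⇒n∣m)
open import Data.Nat.Primality using (Prime)
open import Data.Nat.Tactic.RingSolver using (solve-∀)
open import Data.Product using (∃; ∃₂; _×_; _,_; proj₁; proj₂)
open import Data.Sum using (inj₁; inj₂)
open import Data.Empty using (⊥-elim)
open import Relation.Nullary using (¬_)
open import Relation.Binary.PropositionalEquality as ≡ using (_≡_)

module Arithmetic where

  open import Data.Nat.DivMod using (m<n⇒m%n≡m; m*n%n≡0; [m+kn]%n≡m%n; m≡m%n+[m/n]*n; _/_)
  open import Data.Nat.Divisibility using (_∣?_; ∣1⇒≡1; *-cancelʳ-∣)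
  open import Data.Nat.Induction using (<-rec)
  open import Data.Nat.Coprimality as Coprime using (Coprime; coprime-Bézout; coprime-divisor; prime⇒coprime)
  open import Data.Nat.GCD using (module Bézout)
  open import Data.Nat.Primality using (prime⇒irreducible; prime⇒nonTrivial; prime⇒nonZero)
  open import Data.Fin as Fin using (Fin; toℕ; fromℕ<)
  open import Data.Fin.Properties using (pigeonhole; toℕ-fromℕ<; toℕ<n)
  open import Function using (_∘_)
  open import Relation.Nullary using (yes; no)
  open import Relation.Binary.Bundles using (Setoid)
  import Relation.Binary.Reasoning.Setoid
  open import Relation.Binary.PropositionalEquality

  -- Congruences in ℕ

  infix 4 _≡_mod_

  _≡_mod_ : ℕ → ℕ → ℕ → Set
  _≡_mod_ a b M = ∃₂ λ x y → a + x * M ≡ b + y * M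

  module _ {M : ℕ} where
    open ≡-Reasoning

    mod-refl : ∀ {a} → a ≡ a mod M
    mod-refl = 0 , 0 , refl

    mod-reflexive : ∀ {a b} → a ≡ b → a ≡ b mod M
    mod-reflexive refl = mod-refl

    mod-sym : ∀ {a b} → a ≡ b mod M → b ≡ a mod M
    mod-sym (x , y , eq) = y , x , sym eq

    mod-trans : ∀ {a b c} → a ≡ b mod M → b ≡ c mod M → a ≡ c mod M
    mod-trans {a} {b} {c} (x , y , ab) (x′ , y′ , bc) = x + x′ , y′ + y , (begin
      a + (x + x′) * M      ≡⟨ shift a x x′ M ⟩
      (a + x * M) + x′ * M  ≡⟨ cong (_+ x′ * M) ab ⟩
      (b + y * M) + x′ * M  ≡⟨ swap b y x′ M ⟩
      (b + x′ * M) + y * M  ≡⟨ cong (_+ y * M) bc ⟩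
      (c + y′ * M) + y * M  ≡⟨ shift c y′ y M ⟨
      c + (y′ + y) * M      ∎)
      where
      shift : ∀ a x x′ M → a + (x + x′) * M ≡ (a + x * M) + x′ * M
      shift = solve-∀
      swap : ∀ b y x′ M → (b + y * M) + x′ * M ≡ (b + x′ * M) + y * M
      swap = solve-∀

    mod-*-congˡ : ∀ k {a b} → a ≡ b mod M → k * a ≡ k * b mod M
    mod-*-congˡ k {a} {b} (x , y , eq) = k * x , k * y , (begin
      k * a + k * x * M  ≡⟨ distrib k a x M ⟩
      k * (a + x * M)    ≡⟨ cong (k *_) eq ⟩
      k * (b + y * M)    ≡⟨ distrib k b y M ⟨
      k * b + k * y * M  ∎)
      where
      distrib : ∀ k a x M → k * a + k * x * M ≡ k * (a + x * M)
      distrib = solve-∀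

    mod-*-cong : ∀ {a b c d} → a ≡ b mod M → c ≡ d mod M → a * c ≡ b * d mod M
    mod-*-cong {a} {b} {c} {d} a≡b c≡d = mod-trans
      (subst₂ (_≡_mod M) (*-comm c a) (*-comm c b) (mod-*-congˡ c a≡b))
      (mod-*-congˡ b c≡d)

    mod-^-cong : ∀ {a b} k → a ≡ b mod M → a ^ k ≡ b ^ k mod M
    mod-^-cong zero    a≡b = mod-refl
    mod-^-cong (suc k) a≡b = mod-*-cong a≡b (mod-^-cong k a≡b)

    ^-≡1 : ∀ {r} → r ≡ 1 mod M → ∀ k → r ^ k ≡ 1 mod M
    ^-≡1 {r} r≡1 k = subst (r ^ k ≡_mod M) (^-zeroˡ k) (mod-^-cong k r≡1)

    ∣⇒≡0[mod] : ∀ {a} → M ∣ a → a ≡ 0 mod M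
    ∣⇒≡0[mod] (divides q eq) = 0 , q , trans (+-identityʳ _) eq

    module _ .{{_ : NonZero M}} where

      mod⇒%≡ : ∀ {a b} → a ≡ b mod M → a % M ≡ b % M
      mod⇒%≡ {a} {b} (x , y , eq) = begin
        a % M            ≡⟨ [m+kn]%n≡m%n a x M ⟨
        (a + x * M) % M  ≡⟨ cong (_% M) eq ⟩
        (b + y * M) % M  ≡⟨ [m+kn]%n≡m%n b y M ⟩
        b % M            ∎

      %≡⇒mod : ∀ {a b} → a % M ≡ b % M → a ≡ b mod M
      %≡⇒mod {a} {b} eq = b / M , a / M , (begin
        a + b / M * M                  ≡⟨ cong (_+ b / M * M) (m≡m%n+[m/n]*n a M) ⟩
        a % M + a / M * M + b / M * M  ≡⟨ cong (λ z → z + a / M * M + b / M * M) eq ⟩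
        b % M + a / M * M + b / M * M  ≡⟨ swap (b % M) (a / M * M) (b / M * M) ⟩
        b % M + b / M * M + a / M * M  ≡⟨ cong (_+ a / M * M) (m≡m%n+[m/n]*n b M) ⟨
        b + a / M * M                  ∎)
        where
        swap : ∀ u v w → u + v + w ≡ u + w + v
        swap = solve-∀

  mod-setoid : ℕ → Setoid 0ℓ 0ℓ
  mod-setoid M = record
    { Carrier       = ℕ
    ; _≈_           = _≡_mod M
    ; isEquivalence = record { refl = mod-refl ; sym = mod-sym ; trans = mod-trans }
    }

  module ≡-mod-Reasoning (M : ℕ) = Relation.Binary.Reasoning.Setoid (mod-setoid M)

  mod-weaken : ∀ {M a b} q → a ≡ b mod M * q → a ≡ b mod M
  mod-weaken {M} {a} {b} q (x , y , eq) = x * q , y * q ,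
    trans (cong (a +_) (regroup x M q)) (trans eq (cong (b +_) (sym (regroup y M q))))
    where
    regroup : ∀ x M q → x * q * M ≡ x * (M * q)
    regroup = solve-∀

  1+*≡1[mod] : ∀ p c → 1 + p * c ≡ 1 mod p
  1+*≡1[mod] p c = 0 , c , cong suc (trans (+-identityʳ (p * c)) (*-comm p c))

  module _ {p : ℕ} (1<p : 1 < p) where

    private instance
      p≢0 : NonZero p
      p≢0 = >-nonZero (<-trans z<s 1<p)

    open ≡-Reasoning

    1≢0[mod] : ¬ (1 ≡ 0 mod p)
    1≢0[mod] 1≡0 with trans (sym (m<n⇒m%n≡m 1<p)) (trans (mod⇒%≡ {p} 1≡0) (m*n%n≡0 0 p))
    ... | ()

    ≡1[mod]⇒¬∣ : ∀ {w} → w ≡ 1 mod p → ¬ p ∣ w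
    ≡1[mod]⇒¬∣ w≡1 p∣w = 1≢0[mod] (mod-trans (mod-sym w≡1) (∣⇒≡0[mod] p∣w))

    ≡1[mod]⇒1+* : ∀ {r} → r ≡ 1 mod p → ∃ λ c → r ≡ 1 + p * c
    ≡1[mod]⇒1+* {r} r≡1 = r / p , (begin
      r                  ≡⟨ m≡m%n+[m/n]*n r p ⟩
      r % p + r / p * p  ≡⟨ cong (_+ r / p * p) (trans (mod⇒%≡ {p} r≡1) (m<n⇒m%n≡m 1<p)) ⟩
      1 + r / p * p      ≡⟨ cong suc (*-comm (r / p) p) ⟩
      1 + p * (r / p)    ∎)

  ¬∣⇒coprime : ∀ {p a} → Prime p → ¬ p ∣ a → Coprime a p
  ¬∣⇒coprime p-prime p∤a (d∣a , d∣p) with prime⇒irreducible p-prime d∣p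
  ... | inj₁ d≡1  = d≡1
  ... | inj₂ refl = ⊥-elim (p∤a d∣a)

  coprime-^ʳ : ∀ {a p} → Coprime a p → ∀ N → Coprime a (p ^ N)
  coprime-^ʳ a⊥p zero    (_ , d∣1)        = ∣1⇒≡1 d∣1
  coprime-^ʳ {a} {p} a⊥p (suc N) {d} (d∣a , d∣p*pᴺ) = coprime-^ʳ a⊥p N (d∣a , coprime-divisor d⊥p d∣p*pᴺ)
    where
    d⊥p : Coprime d p
    d⊥p (e∣d , e∣p) = a⊥p (∣-trans e∣d d∣a , e∣p)

  coprime⇒mod-inverse : ∀ {a M} → Coprime a M → ∃ λ x → a * x ≡ 1 mod M
  coprime⇒mod-inverse {a} {M} a⊥M with coprime-Bézout a⊥M
  ... | Bézout.+- x y 1+yM≡xa = x , 0 , y , trans (+-identityʳ (a * x)) (trans (*-comm a x) (sym 1+yM≡xa))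
  -- here x a ≡ -1, so (x a)² ≡ 1
  ... | Bézout.-+ x y 1+xa≡yM = x * (a * x) , 2 * y , y * y * M , (begin
    a * (x * (a * x)) + 2 * y * M        ≡⟨ expand a x y M ⟩
    x * a * (x * a) + 2 * (y * M)        ≡⟨ cong (λ z → x * a * (x * a) + 2 * z) 1+xa≡yM ⟨
    x * a * (x * a) + 2 * (1 + x * a)    ≡⟨ square (x * a) ⟩
    1 + (1 + x * a) * (1 + x * a)        ≡⟨ cong (λ z → 1 + z * z) 1+xa≡yM ⟩
    1 + y * M * (y * M)                  ≡⟨ regroup y M ⟩
    1 + y * y * M * M                    ∎)
    where
    open ≡-Reasoning
    expand : ∀ a x y M → a * (x * (a * x)) + 2 * y * M ≡ x * a * (x * a) + 2 * (y * M)
    expand = solve-∀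
    square : ∀ A → A * A + 2 * (1 + A) ≡ 1 + (1 + A) * (1 + A)
    square = solve-∀
    regroup : ∀ y M → 1 + y * M * (y * M) ≡ 1 + y * y * M * M
    regroup = solve-∀

  module _ {M r : ℕ} where
    open ≡-mod-Reasoning M

    ^-period : ∀ {P a b} → r ^ P ≡ 1 mod M → a ≡ b mod P → r ^ a ≡ r ^ b mod M
    ^-period {P} {a} {b} rᴾ≡1 (x , y , a+xP≡b+yP) =
      mod-trans (mod-sym (drop a x)) (subst (λ z → r ^ z ≡ r ^ b mod M) (sym a+xP≡b+yP) (drop b y))
      where
      drop : ∀ c x → r ^ (c + x * P) ≡ r ^ c mod M
      drop c x = begin
        r ^ (c + x * P)      ≡⟨ ^-distribˡ-+-* r c (x * P) ⟩
        r ^ c * r ^ (x * P)  ≡⟨ cong (λ z → r ^ c * r ^ z) (*-comm x P) ⟩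
        r ^ c * r ^ (P * x)  ≡⟨ cong (r ^ c *_) (^-*-assoc r P x) ⟨
        r ^ c * (r ^ P) ^ x  ≈⟨ mod-*-congˡ (r ^ c) (^-≡1 rᴾ≡1 x) ⟩
        r ^ c * 1            ≡⟨ *-identityʳ (r ^ c) ⟩
        r ^ c                ∎

    module _ {ρ : ℕ} (rρ≡1 : r * ρ ≡ 1 mod M) where

      ^-inverse : ∀ i c → ρ ^ i * (r ^ i * c) ≡ c mod M
      ^-inverse zero    c = mod-reflexive (trans (*-identityˡ (1 * c)) (*-identityˡ c))
      ^-inverse (suc i) c = begin
        ρ * ρ ^ i * (r * r ^ i * c)    ≡⟨ regroup r ρ (ρ ^ i) (r ^ i) c ⟩
        r * ρ * (ρ ^ i * (r ^ i * c))  ≈⟨ mod-*-cong rρ≡1 (^-inverse i c) ⟩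
        1 * c                          ≡⟨ *-identityˡ c ⟩
        c                              ∎
        where
        regroup : ∀ r ρ A B c → ρ * A * (r * B * c) ≡ r * ρ * (A * (B * c))
        regroup = solve-∀

      ^-cancelˡ : ∀ i {a b} → r ^ i * a ≡ r ^ i * b mod M → a ≡ b mod M
      ^-cancelˡ i {a} {b} eq = begin
        a                    ≈⟨ ^-inverse i a ⟨
        ρ ^ i * (r ^ i * a)  ≈⟨ mod-*-congˡ (ρ ^ i) eq ⟩
        ρ ^ i * (r ^ i * b)  ≈⟨ ^-inverse i b ⟩
        b                    ∎

  -- Units modulo a prime

  prime⇒1<p : ∀ {p} → Prime p → 1 < p
  prime⇒1<p {p} p-prime = nonTrivial⇒n>1 p {{prime⇒nonTrivial p-prime}}

  module _ {p : ℕ} (p-prime : Prime p) where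

    private instance
      p≢0 : NonZero p
      p≢0 = prime⇒nonZero p-prime

    pred[p]<p : pred p < p
    pred[p]<p = subst (pred p <_) (suc-pred p) (n<1+n (pred p))

    module _ {r ρ : ℕ} (rρ≡1 : r * ρ ≡ 1 mod p) where

      residue≢0 : ∀ s → r ^ s % p ≢ 0
      residue≢0 s rˢ%p≡0 = 1≢0[mod] (prime⇒1<p p-prime) (mod-trans (mod-sym (^-inverse rρ≡1 s 1)) ρˢrˢ≡0)
        where
        rˢ≡0 : r ^ s ≡ 0 mod p
        rˢ≡0 = %≡⇒mod (trans rˢ%p≡0 (sym (m*n%n≡0 0 p)))
        ρˢrˢ≡0 : ρ ^ s * (r ^ s * 1) ≡ 0 mod p
        ρˢrˢ≡0 = subst (ρ ^ s * (r ^ s * 1) ≡_mod p) (*-zeroʳ (ρ ^ s))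
          (mod-*-congˡ (ρ ^ s) (mod-*-cong rˢ≡0 mod-refl))

      -- shifted down by one, so that it fits into the p - 1 nonzero residues
      residue : Fin p → Fin (pred p)
      residue s = fromℕ< (pred-mono-< {{≢-nonZero (residue≢0 (toℕ s))}} (m%n<n (r ^ toℕ s) p))

      residue-injective : ∀ s t → residue s ≡ residue t → r ^ toℕ s ≡ r ^ toℕ t mod p
      residue-injective s t eq = %≡⇒mod (begin
        r ^ toℕ s % p               ≡⟨ suc-pred (r ^ toℕ s % p) {{≢-nonZero (residue≢0 (toℕ s))}} ⟨
        suc (pred (r ^ toℕ s % p))  ≡⟨ cong suc (toℕ-fromℕ< _) ⟨
        suc (toℕ (residue s))       ≡⟨ cong (suc ∘ toℕ) eq ⟩
        suc (toℕ (residue t))       ≡⟨ cong suc (toℕ-fromℕ< _) ⟩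
        suc (pred (r ^ toℕ t % p))  ≡⟨ suc-pred (r ^ toℕ t % p) {{≢-nonZero (residue≢0 (toℕ t))}} ⟩
        r ^ toℕ t % p               ∎)
        where open ≡-Reasoning

      collision⇒root-of-unity : ∀ {s t : Fin p} → toℕ s < toℕ t → r ^ toℕ s ≡ r ^ toℕ t mod p →
                                ∃ λ e → 0 < e × e < p × r ^ e ≡ 1 mod p
      collision⇒root-of-unity {s} {t} s<t rˢ≡rᵗ =
        e , m<n⇒0<n∸m s<t , ≤-<-trans (m∸n≤m (toℕ t) (toℕ s)) (toℕ<n t) ,
        mod-sym (^-cancelˡ rρ≡1 (toℕ s) (subst₂ (_≡_mod p) (sym (*-identityʳ (r ^ toℕ s))) split rˢ≡rᵗ))
        where
        e : ℕ
        e = toℕ t ∸ toℕ s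
        split : r ^ toℕ t ≡ r ^ toℕ s * r ^ e
        split = trans (cong (r ^_) (sym (m+[n∸m]≡n (<⇒≤ s<t)))) (^-distribˡ-+-* r (toℕ s) e)

      unit-order<p : ∃ λ e → 0 < e × e < p × r ^ e ≡ 1 mod p
      unit-order<p = from-collision (pigeonhole pred[p]<p residue)
        where
        from-collision : (∃₂ λ s t → s Fin.< t × residue s ≡ residue t) → ∃ λ e → 0 < e × e < p × r ^ e ≡ 1 mod p
        from-collision (s , t , s<t , same) = collision⇒root-of-unity s<t (residue-injective s t same)

    ^[pⁿ]≡1⇒≡1 : ∀ {r} n → r ^ (p ^ n) ≡ 1 mod p → r ≡ 1 mod p
    ^[pⁿ]≡1⇒≡1 {r} n rᴾ≡1 = from-root (unit-order<p r-unit)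
      where
      r-unit : r * r ^ pred (p ^ n) ≡ 1 mod p
      r-unit = subst (λ z → r ^ z ≡ 1 mod p) (sym (suc-pred (p ^ n) {{m^n≢0 p n}})) rᴾ≡1
      -- e is coprime to p ^ n, so 1 is a multiple of e modulo the period p ^ n of r
      from-root : (∃ λ e → 0 < e × e < p × r ^ e ≡ 1 mod p) → r ≡ 1 mod p
      from-root (e , 0<e , e<p , rᵉ≡1) = begin
        r            ≡⟨ *-identityʳ r ⟨
        r ^ 1        ≈⟨ ^-period rᴾ≡1 (mod-sym eα≡1) ⟩
        r ^ (e * α)  ≡⟨ ^-*-assoc r e α ⟨
        (r ^ e) ^ α  ≈⟨ ^-≡1 rᵉ≡1 α ⟩
        1            ∎
        where
        open ≡-mod-Reasoning p
        e⊥p : Coprime e p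
        e⊥p = Coprime.sym (prime⇒coprime p-prime {{>-nonZero 0<e}} e<p)
        e⁻¹ : ∃ λ α → e * α ≡ 1 mod p ^ n
        e⁻¹ = coprime⇒mod-inverse (coprime-^ʳ e⊥p n)
        α : ℕ
        α = proj₁ e⁻¹
        eα≡1 : e * α ≡ 1 mod p ^ n
        eα≡1 = proj₂ e⁻¹

  -- Geometric sums

  odd⇒1+*2 : ∀ {p} → ¬ 2 ∣ p → ∃ λ h → p ≡ 1 + h * 2
  odd⇒1+*2 {p} 2∤p with p % 2 in p%2 | m%n<n p 2
  ... | zero        | _ = ⊥-elim (2∤p (m%n≡0⇒n∣m p 2 p%2))
  ... | suc zero    | _ = p / 2 , trans (m≡m%n+[m/n]*n p 2) (cong (_+ p / 2 * 2) p%2)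
  ... | suc (suc _) | s≤s (s≤s ())

  geometric : ℕ → ℕ → ℕ
  geometric r zero    = 0
  geometric r (suc N) = 1 + r * geometric r N

  triangular : ℕ → ℕ
  triangular zero    = 0
  triangular (suc N) = triangular N + N

  module _ where
    open ≡-Reasoning

    geometric-+ : ∀ r a b → geometric r (a + b) ≡ geometric r a + r ^ a * geometric r b
    geometric-+ r zero    b = sym (+-identityʳ (geometric r b))
    geometric-+ r (suc a) b = begin
      1 + r * geometric r (a + b)                        ≡⟨ cong (λ z → 1 + r * z) (geometric-+ r a b) ⟩
      1 + r * (geometric r a + r ^ a * geometric r b)    ≡⟨ distrib r (geometric r a) (r ^ a) (geometric r b) ⟩
      1 + r * geometric r a + r * r ^ a * geometric r b  ∎
      where
      distrib : ∀ r A P B → 1 + r * (A + P * B) ≡ 1 + r * A + r * P * B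
      distrib = solve-∀

    geometric-* : ∀ r a b → geometric r (a * b) ≡ geometric r a * geometric (r ^ a) b
    geometric-* r a zero    = trans (cong (geometric r) (*-zeroʳ a)) (sym (*-zeroʳ (geometric r a)))
    geometric-* r a (suc b) = begin
      geometric r (a * suc b)                                        ≡⟨ cong (geometric r) (*-suc a b) ⟩
      geometric r (a + a * b)                                        ≡⟨ geometric-+ r a (a * b) ⟩
      geometric r a + r ^ a * geometric r (a * b)                    ≡⟨ cong (λ z → geometric r a + r ^ a * z) (geometric-* r a b) ⟩
      geometric r a + r ^ a * (geometric r a * geometric (r ^ a) b)  ≡⟨ factor (geometric r a) (r ^ a) (geometric (r ^ a) b) ⟩
      geometric r a * (1 + r ^ a * geometric (r ^ a) b)              ∎
      where
      factor : ∀ A R T → A + R * (A * T) ≡ A * (1 + R * T)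
      factor = solve-∀

    -- (1 + p d) ^ i ≡ 1 + i p d modulo p², summed over i < N
    geometric-1+p* : ∀ p d N → ∃ λ Y → geometric (1 + p * d) N ≡ N + p * d * triangular N + p * p * Y
    geometric-1+p* p d zero    = 0 , zeros p d
      where
      zeros : ∀ p d → 0 ≡ 0 + p * d * 0 + p * p * 0
      zeros = solve-∀
    geometric-1+p* p d (suc N) with geometric-1+p* p d N
    ... | Y , eq = Y + d * d * triangular N + d * p * Y , (begin
      1 + (1 + p * d) * geometric (1 + p * d) N                 ≡⟨ cong (λ z → 1 + (1 + p * d) * z) eq ⟩
      1 + (1 + p * d) * (N + p * d * triangular N + p * p * Y)  ≡⟨ expand p d N (triangular N) Y ⟩
      suc N + p * d * (triangular N + N) + p * p * (Y + d * d * triangular N + d * p * Y) ∎)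
      where
      expand : ∀ p d N T Y → 1 + (1 + p * d) * (N + p * d * T + p * p * Y)
                            ≡ suc N + p * d * (T + N) + p * p * (Y + d * d * T + d * p * Y)
      expand = solve-∀

    triangular-odd : ∀ h → triangular (1 + h * 2) ≡ h * (1 + h * 2)
    triangular-odd zero    = refl
    triangular-odd (suc h) = begin
      triangular (1 + h * 2) + (1 + h * 2) + (2 + h * 2)  ≡⟨ cong (λ z → z + (1 + h * 2) + (2 + h * 2)) (triangular-odd h) ⟩
      h * (1 + h * 2) + (1 + h * 2) + (2 + h * 2)         ≡⟨ collect h ⟩
      suc h * (1 + suc h * 2)                             ∎
      where
      collect : ∀ h → h * (1 + h * 2) + (1 + h * 2) + (2 + h * 2) ≡ suc h * (1 + suc h * 2)
      collect = solve-∀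

  module _ {p h : ℕ} (p≡1+h*2 : p ≡ 1 + h * 2) where

    -- the first-order term p d · p (p - 1) / 2 is divisible by p² because p is odd
    geometric-odd : ∀ d → ∃ λ a → geometric (1 + p * d) p ≡ p * (1 + p * a)
    geometric-odd d with geometric-1+p* p d p
    ... | Y , eq = d * h + Y , (begin
      geometric (1 + p * d) p                         ≡⟨ eq ⟩
      p + p * d * triangular p + p * p * Y            ≡⟨ cong (λ z → p + p * d * triangular z + p * p * Y) p≡1+h*2 ⟩
      p + p * d * triangular (1 + h * 2) + p * p * Y  ≡⟨ cong (λ z → p + p * d * z + p * p * Y) (triangular-odd h) ⟩
      p + p * d * (h * (1 + h * 2)) + p * p * Y       ≡⟨ cong (λ z → p + p * d * (h * z) + p * p * Y) p≡1+h*2 ⟨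
      p + p * d * (h * p) + p * p * Y                 ≡⟨ collect p d h Y ⟩
      p * (1 + p * (d * h + Y))                       ∎)
      where
      open ≡-Reasoning
      collect : ∀ p d h Y → p + p * d * (h * p) + p * p * Y ≡ p * (1 + p * (d * h + Y))
      collect = solve-∀

    geometric-lifting : 1 < p → ∀ {r} → r ≡ 1 mod p → ∀ t →
                        ∃ λ w → geometric r (p ^ t) ≡ p ^ t * w × (w ≡ 1 mod p)
    geometric-lifting 1<p {r} r≡1 zero = 1 , cong suc (*-zeroʳ r) , mod-refl
    geometric-lifting 1<p {r} r≡1 (suc t)
      with ≡1[mod]⇒1+* 1<p r≡1 | geometric-lifting 1<p (^-≡1 r≡1 p) t
    ... | c , refl | w , eq , w≡1 with geometric-odd c
    ... | a , eqa = (1 + p * a) * w , (begin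
      geometric r (p * p ^ t)                    ≡⟨ geometric-* r p (p ^ t) ⟩
      geometric r p * geometric (r ^ p) (p ^ t)  ≡⟨ cong₂ _*_ eqa eq ⟩
      p * (1 + p * a) * (p ^ t * w)              ≡⟨ regroup p (1 + p * a) (p ^ t) w ⟩
      p * p ^ t * ((1 + p * a) * w)              ∎) , mod-*-cong (1+*≡1[mod] p a) w≡1
      where
      open ≡-Reasoning
      regroup : ∀ p A P w → p * A * (P * w) ≡ p * P * (A * w)
      regroup = solve-∀

  module _ {p : ℕ} (p-prime : Prime p) (p-odd : ¬ 2 ∣ p) where

    private instance
      p≢0 : NonZero p
      p≢0 = prime⇒nonZero p-prime

    geometric-prime-power : ∀ {r} → r ≡ 1 mod p → ∀ t →
                            ∃ λ w → geometric r (p ^ t) ≡ p ^ t * w × (∀ M → Coprime w (p ^ M))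
    geometric-prime-power r≡1 t with odd⇒1+*2 p-odd
    ... | h , p≡1+h*2 with geometric-lifting {h = h} p≡1+h*2 (prime⇒1<p p-prime) r≡1 t
    ... | w , eq , w≡1 = w , eq , coprime-^ʳ (¬∣⇒coprime p-prime (≡1[mod]⇒¬∣ (prime⇒1<p p-prime) w≡1))

    ∣*geometric⇒∣ : ∀ {r} → r ≡ 1 mod p → ∀ {i} s e → p ^ (s + e) ∣ i * geometric r (p ^ e) → p ^ s ∣ i
    ∣*geometric⇒∣ r≡1 {i} s e ∣i*geom with geometric-prime-power r≡1 e
    ... | w , eq , w⊥ = *-cancelʳ-∣ (p ^ e) {{m^n≢0 p e}}
      (subst (_∣ i * p ^ e) (^-distribˡ-+-* p s e)
        (coprime-divisor (Coprime.sym (w⊥ (s + e)))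
          (subst (p ^ (s + e) ∣_) (trans (cong (i *_) eq) (regroup i (p ^ e) w)) ∣i*geom)))
      where
      regroup : ∀ i P w → i * (P * w) ≡ w * (i * P)
      regroup = solve-∀

    ∣⇒≡*geometric : ∀ {r} → r ≡ 1 mod p → ∀ {i} k M → p ^ k ∣ i →
                    ∃ λ a → a * geometric r (p ^ k) ≡ i mod p ^ M
    ∣⇒≡*geometric {r} r≡1 k M (divides q refl) with geometric-prime-power r≡1 k
    ... | w , eq , w⊥ with coprime⇒mod-inverse (w⊥ M)
    ... | x , wx≡1 = q * x , (begin
      q * x * geometric r (p ^ k)  ≡⟨ cong (q * x *_) eq ⟩
      q * x * (p ^ k * w)          ≡⟨ regroup q x (p ^ k) w ⟩
      q * p ^ k * (w * x)          ≈⟨ mod-*-congˡ (q * p ^ k) wx≡1 ⟩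
      q * p ^ k * 1                ≡⟨ *-identityʳ (q * p ^ k) ⟩
      q * p ^ k                    ∎)
      where
      open ≡-mod-Reasoning (p ^ M)
      regroup : ∀ q x P w → q * x * (P * w) ≡ q * P * (w * x)
      regroup = solve-∀

  module _ {p : ℕ} (1<p : 1 < p) where

    p-adic-split : ∀ j → 0 < j → ∃₂ λ k u → j ≡ p ^ k * u × ¬ p ∣ u
    p-adic-split = <-rec _ split
      where
      split : ∀ j → (∀ {i} → i < j → 0 < i → ∃₂ λ k u → i ≡ p ^ k * u × ¬ p ∣ u) →
              0 < j → ∃₂ λ k u → j ≡ p ^ k * u × ¬ p ∣ u
      split j rec 0<j with p ∣? j
      ... | no  p∤j = 0 , j , sym (+-identityʳ j) , p∤j
      ... | yes (divides q refl) with rec q<q*p (n≢0⇒n>0 q≢0)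
        where
        q≢0 : q ≢ 0
        q≢0 refl = <-irrefl refl 0<j
        q<q*p : q < q * p
        q<q*p = m<m*n q p {{≢-nonZero q≢0}} 1<p
      ... | k , u , refl , p∤u = suc k , u , regroup (p ^ k) u p , p∤u
        where
        regroup : ∀ P u p → P * u * p ≡ p * P * u
        regroup = solve-∀

open Arithmetic
open import Data.Integer using (+_; -[1+_])

-- Powers in a group

module Powers {c ℓ : Level} (G : Group c ℓ) where
  open Group G
  open GroupDefs G renaming (_^_ to _^ℤ_)
  open import Algebra.Properties.Group G using (identityʳ-unique; inverseʳ-unique; ⁻¹-involutive; ε⁻¹≈ε)
  open import Algebra.Properties.Monoid.Mult monoid using (×-homo-+; ×-assocˡ; ×-congʳ) renaming (_×_ to _·_)
  open import Relation.Binary.Reasoning.Setoid setoid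

  ^ℕ≡· : ∀ x k → x ^ℕ k ≡ k · x
  ^ℕ≡· x zero    = ≡.refl
  ^ℕ≡· x (suc k) = ≡.cong (x ∙_) (^ℕ≡· x k)

  ^ℕ-homo-+ : ∀ x a b → x ^ℕ (a + b) ≈ x ^ℕ a ∙ x ^ℕ b
  ^ℕ-homo-+ x a b rewrite ^ℕ≡· x (a + b) | ^ℕ≡· x a | ^ℕ≡· x b = ×-homo-+ x a b

  ^ℕ-assoc : ∀ x a b → (x ^ℕ b) ^ℕ a ≈ x ^ℕ (a * b)
  ^ℕ-assoc x a b rewrite ^ℕ≡· x b | ^ℕ≡· (b · x) a | ^ℕ≡· x (a * b) = ×-assocˡ x a b

  ^ℕ-congˡ : ∀ {x y} a → x ≈ y → x ^ℕ a ≈ y ^ℕ a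
  ^ℕ-congˡ {x} {y} a x≈y rewrite ^ℕ≡· x a | ^ℕ≡· y a = ×-congʳ a x≈y

  ^ℕ-congʳ : ∀ x {a b} → a ≡ b → x ^ℕ a ≈ x ^ℕ b
  ^ℕ-congʳ x a≡b = reflexive (≡.cong (x ^ℕ_) a≡b)

  ε-^ℕ : ∀ a → ε ^ℕ a ≈ ε
  ε-^ℕ zero    = refl
  ε-^ℕ (suc a) = trans (identityˡ _) (ε-^ℕ a)

  module _ {x : Carrier} {K : ℕ} (xᴷ≈ε : x ^ℕ K ≈ ε) where

    ^ℕ-multiple≈ε : ∀ q → x ^ℕ (q * K) ≈ ε
    ^ℕ-multiple≈ε q = begin
      x ^ℕ (q * K)   ≈⟨ ^ℕ-assoc x q K ⟨
      (x ^ℕ K) ^ℕ q  ≈⟨ ^ℕ-congˡ q xᴷ≈ε ⟩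
      ε ^ℕ q         ≈⟨ ε-^ℕ q ⟩
      ε              ∎

    ^ℕ-mod : ∀ {a b} → a ≡ b mod K → x ^ℕ a ≈ x ^ℕ b
    ^ℕ-mod {a} {b} (q , q′ , a+qK≡b+q′K) = begin
      x ^ℕ a             ≈⟨ drop a q ⟨
      x ^ℕ (a + q * K)   ≈⟨ ^ℕ-congʳ x a+qK≡b+q′K ⟩
      x ^ℕ (b + q′ * K)  ≈⟨ drop b q′ ⟩
      x ^ℕ b             ∎
      where
      drop : ∀ c q → x ^ℕ (c + q * K) ≈ x ^ℕ c
      drop c q = trans (^ℕ-homo-+ x c (q * K)) (trans (∙-congˡ (^ℕ-multiple≈ε q)) (identityʳ _))

    ^ℤ-as-^ℕ : 0 < K → ∀ z → ∃ λ k → x ^ℤ z ≈ x ^ℕ k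
    ^ℤ-as-^ℕ 0<K (+ k)    = k , refl
    ^ℤ-as-^ℕ 0<K -[1+ k ] = pred K * suc k , sym (inverseʳ-unique _ _ (begin
      x ^ℕ suc k ∙ x ^ℕ (pred K * suc k)  ≈⟨ ^ℕ-homo-+ x (suc k) (pred K * suc k) ⟨
      x ^ℕ (suc k + pred K * suc k)        ≡⟨ ≡.cong (λ l → x ^ℕ (l * suc k)) (suc-pred K {{>-nonZero 0<K}}) ⟩
      x ^ℕ (K * suc k)                     ≡⟨ ≡.cong (x ^ℕ_) (*-comm K (suc k)) ⟩
      x ^ℕ (suc k * K)                     ≈⟨ ^ℕ-multiple≈ε (suc k) ⟩
      ε                                    ∎))

  ⁻¹-∈⟨⟩ : ∀ {x y} → y ∈⟨ x ⟩ → (y ⁻¹) ∈⟨ x ⟩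
  ⁻¹-∈⟨⟩ (+ zero   , ε≈y)   = + zero , trans (sym ε⁻¹≈ε) (⁻¹-cong ε≈y)
  ⁻¹-∈⟨⟩ (+ suc k  , xᵏ≈y)  = -[1+ k ] , ⁻¹-cong xᵏ≈y
  ⁻¹-∈⟨⟩ (-[1+ k ] , x⁻ᵏ≈y) = + suc k , trans (sym (⁻¹-involutive _)) (⁻¹-cong x⁻ᵏ≈y)

  ∈⟨⟩-resp-≈ : ∀ {x y z} → y ≈ z → y ∈⟨ x ⟩ → z ∈⟨ x ⟩
  ∈⟨⟩-resp-≈ y≈z (k , xᵏ≈y) = k , trans xᵏ≈y y≈z

  module _ {x : Carrier} {K : ℕ} (x-order : HasOrder x K) where

    private
      xᴷ≈ε : x ^ℕ K ≈ ε
      xᴷ≈ε = proj₁ (proj₂ x-order)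

      instance
        K≢0 : NonZero K
        K≢0 = >-nonZero (proj₁ x-order)

    order-∣ : ∀ {a} → x ^ℕ a ≈ ε → K ∣ a
    order-∣ {a} xᵃ≈ε with a % K in a%K | m%n<n a K
    ... | zero  | _     = m%n≡0⇒n∣m a K a%K
    ... | suc t | t+1<K = ⊥-elim (proj₂ (proj₂ x-order) (suc t) z<s t+1<K (begin
      x ^ℕ suc t    ≡⟨ ≡.cong (x ^ℕ_) a%K ⟨
      x ^ℕ (a % K)  ≈⟨ ^ℕ-mod xᴷ≈ε (%≡⇒mod {K} {a} {a % K} (≡.sym (m%n%n≡m%n a K))) ⟨
      x ^ℕ a        ≈⟨ xᵃ≈ε ⟩
      ε             ∎))

    order-≡mod-≤ : ∀ {a b} → a ≤ b → x ^ℕ a ≈ x ^ℕ b → a ≡ b mod K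
    order-≡mod-≤ {a} {b} a≤b xᵃ≈xᵇ with order-∣ (identityʳ-unique (x ^ℕ a) (x ^ℕ (b ∸ a)) (begin
      x ^ℕ a ∙ x ^ℕ (b ∸ a)  ≈⟨ ^ℕ-homo-+ x a (b ∸ a) ⟨
      x ^ℕ (a + (b ∸ a))     ≡⟨ ≡.cong (x ^ℕ_) (m+[n∸m]≡n a≤b) ⟩
      x ^ℕ b                 ≈⟨ xᵃ≈xᵇ ⟨
      x ^ℕ a                 ∎))
    ... | divides q b∸a≡qK = q , 0 , ≡.trans (≡.cong (λ z → a + z) (≡.sym b∸a≡qK))
                                       (≡.trans (m+[n∸m]≡n a≤b) (≡.sym (+-identityʳ b)))

    order-≡mod : ∀ {a b} → x ^ℕ a ≈ x ^ℕ b → a ≡ b mod K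
    order-≡mod {a} {b} xᵃ≈xᵇ with ≤-total a b
    ... | inj₁ a≤b = order-≡mod-≤ a≤b xᵃ≈xᵇ
    ... | inj₂ b≤a = mod-sym (order-≡mod-≤ b≤a (sym xᵃ≈xᵇ))

  generates⇒^ℕ : ∀ {σ τ K L} → Generates σ τ → σ ^ℕ K ≈ ε → 0 < K → τ ^ℕ L ≈ ε → 0 < L →
                 ∀ g → ∃₂ λ i j → g ≈ σ ^ℕ i ∙ τ ^ℕ j
  generates⇒^ℕ σ-τ-generate σᴷ≈ε 0<K τᴸ≈ε 0<L g with σ-τ-generate g
  ... | y , z , g≈σʸτᶻ with ^ℤ-as-^ℕ σᴷ≈ε 0<K y | ^ℤ-as-^ℕ τᴸ≈ε 0<L z
  ... | i , σʸ≈σⁱ | j , τᶻ≈τʲ = i , j , trans g≈σʸτᶻ (∙-cong σʸ≈σⁱ τᶻ≈τʲ)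

  -- Conjugation acting on a cyclic subgroup

  twist-^ℕ : ∀ {σ t r} → t ∙ σ ≈ σ ^ℕ r ∙ t → ∀ a → t ∙ σ ^ℕ a ≈ σ ^ℕ (a * r) ∙ t
  twist-^ℕ tσ≈σʳt zero    = trans (identityʳ _) (sym (identityˡ _))
  twist-^ℕ {σ} {t} {r} tσ≈σʳt (suc a) = begin
    t ∙ (σ ∙ σ ^ℕ a)             ≈⟨ assoc _ _ _ ⟨
    (t ∙ σ) ∙ σ ^ℕ a             ≈⟨ ∙-congʳ tσ≈σʳt ⟩
    (σ ^ℕ r ∙ t) ∙ σ ^ℕ a        ≈⟨ assoc _ _ _ ⟩
    σ ^ℕ r ∙ (t ∙ σ ^ℕ a)        ≈⟨ ∙-congˡ (twist-^ℕ tσ≈σʳt a) ⟩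
    σ ^ℕ r ∙ (σ ^ℕ (a * r) ∙ t)  ≈⟨ assoc _ _ _ ⟨
    (σ ^ℕ r ∙ σ ^ℕ (a * r)) ∙ t  ≈⟨ ∙-congʳ (^ℕ-homo-+ σ r (a * r)) ⟨
    σ ^ℕ (r + a * r) ∙ t         ∎

  normal⇒twist : ∀ {σ K} → NormalCyclic σ → σ ^ℕ K ≈ ε → 0 < K →
                 ∀ t → ∃ λ r → ∀ a → t ∙ σ ^ℕ a ≈ σ ^ℕ (a * r) ∙ t
  normal⇒twist {σ} σ-normal σᴷ≈ε 0<K t with σ-normal t
  ... | z , σᶻ≈tσt⁻¹ with ^ℤ-as-^ℕ σᴷ≈ε 0<K z
  ... | r , σᶻ≈σʳ = r , twist-^ℕ (begin
    t ∙ σ                 ≈⟨ identityʳ _ ⟨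
    (t ∙ σ) ∙ ε           ≈⟨ ∙-congˡ (inverseˡ t) ⟨
    (t ∙ σ) ∙ (t ⁻¹ ∙ t)  ≈⟨ assoc _ _ _ ⟨
    ((t ∙ σ) ∙ t ⁻¹) ∙ t  ≈⟨ ∙-congʳ (trans (sym σᶻ≈tσt⁻¹) σᶻ≈σʳ) ⟩
    σ ^ℕ r ∙ t            ∎)

  module Twisted (σ t : Carrier) (r : ℕ) (twist : ∀ a → t ∙ σ ^ℕ a ≈ σ ^ℕ (a * r) ∙ t) where

    twisted-commute : ∀ c a → t ^ℕ c ∙ σ ^ℕ a ≈ σ ^ℕ (a * r ^ c) ∙ t ^ℕ c
    twisted-commute zero    a = trans (identityˡ _) (trans (^ℕ-congʳ σ (≡.sym (*-identityʳ a))) (sym (identityʳ _)))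
    twisted-commute (suc c) a = begin
      (t ∙ t ^ℕ c) ∙ σ ^ℕ a                  ≈⟨ assoc _ _ _ ⟩
      t ∙ (t ^ℕ c ∙ σ ^ℕ a)                  ≈⟨ ∙-congˡ (twisted-commute c a) ⟩
      t ∙ (σ ^ℕ (a * r ^ c) ∙ t ^ℕ c)        ≈⟨ assoc _ _ _ ⟨
      (t ∙ σ ^ℕ (a * r ^ c)) ∙ t ^ℕ c        ≈⟨ ∙-congʳ (twist (a * r ^ c)) ⟩
      (σ ^ℕ (a * r ^ c * r) ∙ t) ∙ t ^ℕ c    ≈⟨ assoc _ _ _ ⟩
      σ ^ℕ (a * r ^ c * r) ∙ (t ∙ t ^ℕ c)    ≡⟨ ≡.cong (λ k → σ ^ℕ k ∙ (t ∙ t ^ℕ c)) (regroup a (r ^ c) r) ⟩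
      σ ^ℕ (a * (r * r ^ c)) ∙ (t ∙ t ^ℕ c)  ∎
      where
      regroup : ∀ a A r → a * A * r ≡ a * (r * A)
      regroup = solve-∀

    twisted-power : ∀ b N → (σ ^ℕ b ∙ t) ^ℕ N ≈ σ ^ℕ (b * geometric r N) ∙ t ^ℕ N
    twisted-power b zero    = trans (sym (identityˡ ε)) (∙-congʳ (^ℕ-congʳ σ (≡.sym (*-zeroʳ b))))
    twisted-power b (suc N) = begin
      (σ ^ℕ b ∙ t) ∙ (σ ^ℕ b ∙ t) ^ℕ N                   ≈⟨ ∙-congˡ (twisted-power b N) ⟩
      (σ ^ℕ b ∙ t) ∙ (σ ^ℕ B ∙ t ^ℕ N)                   ≈⟨ assoc _ _ _ ⟩
      σ ^ℕ b ∙ (t ∙ (σ ^ℕ B ∙ t ^ℕ N))                   ≈⟨ ∙-congˡ (assoc _ _ _) ⟨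
      σ ^ℕ b ∙ ((t ∙ σ ^ℕ B) ∙ t ^ℕ N)                   ≈⟨ ∙-congˡ (∙-congʳ (twist B)) ⟩
      σ ^ℕ b ∙ ((σ ^ℕ (B * r) ∙ t) ∙ t ^ℕ N)             ≈⟨ ∙-congˡ (assoc _ _ _) ⟩
      σ ^ℕ b ∙ (σ ^ℕ (B * r) ∙ (t ∙ t ^ℕ N))             ≈⟨ assoc _ _ _ ⟨
      (σ ^ℕ b ∙ σ ^ℕ (B * r)) ∙ (t ∙ t ^ℕ N)             ≈⟨ ∙-congʳ (^ℕ-homo-+ σ b (B * r)) ⟨
      σ ^ℕ (b + B * r) ∙ (t ∙ t ^ℕ N)                    ≡⟨ ≡.cong (λ k → σ ^ℕ k ∙ (t ∙ t ^ℕ N)) (regroup b r (geometric r N)) ⟩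
      σ ^ℕ (b * (1 + r * geometric r N)) ∙ (t ∙ t ^ℕ N)  ∎
      where
      B : ℕ
      B = b * geometric r N
      regroup : ∀ b r T → b + b * T * r ≡ b * (1 + r * T)
      regroup = solve-∀

    twisted-order : ∀ {a N} → TrivialIntersection σ t → HasOrder t N → (σ ^ℕ a ∙ t) ^ℕ N ≈ ε →
                    HasOrder (σ ^ℕ a ∙ t) N
    twisted-order {a} {N} σ∩t (0<N , _ , t-minimal) [σᵃt]ᴺ≈ε = 0<N , [σᵃt]ᴺ≈ε , minimal
      where
      minimal : ∀ J → 0 < J → J < N → ¬ (σ ^ℕ a ∙ t) ^ℕ J ≈ ε
      minimal J 0<J J<N [σᵃt]ᴶ≈ε = t-minimal J 0<J J<N (σ∩t (t ^ℕ J) tᴶ∈⟨σ⟩ (+ J , refl))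
        where
        tᴶ∈⟨σ⟩ : (t ^ℕ J) ∈⟨ σ ⟩
        tᴶ∈⟨σ⟩ = ∈⟨⟩-resp-≈ (sym (inverseʳ-unique _ _ (trans (sym (twisted-power a J)) [σᵃt]ᴶ≈ε)))
                            (⁻¹-∈⟨⟩ (+ (a * geometric r J) , refl))

    twist-exponent≡1 : ∀ {p m} n → Prime p → 0 < m → HasOrder σ (p ^ m) → t ^ℕ (p ^ n) ≈ ε → r ≡ 1 mod p
    twist-exponent≡1 {m = zero} _ _ () _ _
    twist-exponent≡1 {p} {suc m} n p-prime _ σ-order tᴾⁿ≈ε =
      ^[pⁿ]≡1⇒≡1 p-prime n (mod-sym (mod-weaken (p ^ m) (order-≡mod σ-order σ≈σ^rᴾⁿ)))
      where
      σ≈σ^rᴾⁿ : σ ^ℕ 1 ≈ σ ^ℕ (r ^ (p ^ n))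
      σ≈σ^rᴾⁿ = begin
        σ ^ℕ 1                                 ≈⟨ identityˡ _ ⟨
        ε ∙ σ ^ℕ 1                             ≈⟨ ∙-congʳ tᴾⁿ≈ε ⟨
        t ^ℕ (p ^ n) ∙ σ ^ℕ 1                  ≈⟨ twisted-commute (p ^ n) 1 ⟩
        σ ^ℕ (1 * r ^ (p ^ n)) ∙ t ^ℕ (p ^ n)  ≈⟨ ∙-cong (^ℕ-congʳ σ (*-identityˡ (r ^ (p ^ n)))) tᴾⁿ≈ε ⟩
        σ ^ℕ (r ^ (p ^ n)) ∙ ε                 ≈⟨ identityʳ _ ⟩
        σ ^ℕ (r ^ (p ^ n))                     ∎

-- A cyclic complement of ⟨σ⟩ through g

module CyclicComplement {c ℓ : Level} (G : Group c ℓ) where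
  open Group G
  open GroupDefs G using (_^ℕ_; _∈⟨_⟩; HasOrder; TrivialIntersection)
  open Powers G
  open import Relation.Binary.Reasoning.Setoid setoid

  module _ {p m n : ℕ} (p-prime : Prime p) (p-odd : ¬ 2 ∣ p) (n≤m : n ≤ m)
           {σ τ : Carrier} (r : ℕ)
           (σ-order : HasOrder σ (p ^ m)) (τ-order : HasOrder τ (p ^ n))
           (twist : ∀ a → τ ∙ σ ^ℕ a ≈ σ ^ℕ (a * r) ∙ τ) (r≡1 : r ≡ 1 mod p)
           (σ∩τ : TrivialIntersection σ τ)
           {g : Carrier} (i j : ℕ) (g≈σⁱτʲ : g ≈ σ ^ℕ i ∙ τ ^ℕ j) (g≉ε : ¬ g ≈ ε)
           (g∩σ : TrivialIntersection g σ) where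

    open Twisted σ τ r twist

    private
      σᴾᵐ≈ε : σ ^ℕ (p ^ m) ≈ ε
      σᴾᵐ≈ε = proj₁ (proj₂ σ-order)

      τᴾⁿ≈ε : τ ^ℕ (p ^ n) ≈ ε
      τᴾⁿ≈ε = proj₁ (proj₂ τ-order)

    ⟨g⟩∩⟨σ⟩ : ∀ N X → g ^ℕ N ≈ σ ^ℕ X → g ^ℕ N ≈ ε
    ⟨g⟩∩⟨σ⟩ N X gᴺ≈σˣ = g∩σ (g ^ℕ N) (+ N , refl) (+ X , sym gᴺ≈σˣ)

    g-power : ∀ N → g ^ℕ N ≈ σ ^ℕ (i * geometric (r ^ j) N) ∙ τ ^ℕ (N * j)
    g-power N = begin
      g ^ℕ N                                          ≈⟨ ^ℕ-congˡ N g≈σⁱτʲ ⟩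
      (σ ^ℕ i ∙ τ ^ℕ j) ^ℕ N                          ≈⟨ Twisted.twisted-power σ (τ ^ℕ j) (r ^ j) (twisted-commute j) i N ⟩
      σ ^ℕ (i * geometric (r ^ j) N) ∙ (τ ^ℕ j) ^ℕ N  ≈⟨ ∙-congˡ (^ℕ-assoc τ N j) ⟩
      σ ^ℕ (i * geometric (r ^ j) N) ∙ τ ^ℕ (N * j)   ∎

    gᴾⁿ≈ε : g ^ℕ (p ^ n) ≈ ε
    gᴾⁿ≈ε = ⟨g⟩∩⟨σ⟩ (p ^ n) (i * geometric (r ^ j) (p ^ n)) (trans (g-power (p ^ n))
      (trans (∙-congˡ (trans (^ℕ-congʳ τ (*-comm (p ^ n) j)) (^ℕ-multiple≈ε τᴾⁿ≈ε j))) (identityʳ _)))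

    τʲ≉ε : ¬ τ ^ℕ j ≈ ε
    τʲ≉ε τʲ≈ε = g≉ε (begin
      g       ≈⟨ identityʳ g ⟨
      g ^ℕ 1  ≈⟨ ⟨g⟩∩⟨σ⟩ 1 i g¹≈σⁱ ⟩
      ε       ∎)
      where
      g¹≈σⁱ : g ^ℕ 1 ≈ σ ^ℕ i
      g¹≈σⁱ = trans (identityʳ g) (trans g≈σⁱτʲ (trans (∙-congˡ τʲ≈ε) (identityʳ _)))

    0<j : 0 < j
    0<j = n≢0⇒n>0 λ j≡0 → τʲ≉ε (^ℕ-congʳ τ j≡0)

    k<n : ∀ {k u} → j ≡ p ^ k * u → k < n
    k<n {k} {u} j≡pᵏu = ≰⇒> λ n≤k → τʲ≉ε (trans (^ℕ-congʳ τ (j≡qpⁿ n≤k)) (^ℕ-multiple≈ε τᴾⁿ≈ε (p ^ (k ∸ n) * u)))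
      where
      j≡qpⁿ : n ≤ k → j ≡ p ^ (k ∸ n) * u * p ^ n
      j≡qpⁿ n≤k = ≡.trans j≡pᵏu (≡.trans (≡.cong (λ l → p ^ l * u) (≡.sym (m+[n∸m]≡n n≤k)))
        (≡.trans (≡.cong (_* u) (^-distribˡ-+-* p n (k ∸ n))) (regroup (p ^ n) (p ^ (k ∸ n)) u)))
        where
        regroup : ∀ A B u → A * B * u ≡ B * u * A
        regroup = solve-∀

    module Split {k u e : ℕ} (j≡pᵏu : j ≡ p ^ k * u) (p∤u : ¬ p ∣ u) (k+e≡n : k + e ≡ n) where

      private
        pⁿ≡pᵉpᵏ : p ^ n ≡ p ^ e * p ^ k
        pⁿ≡pᵉpᵏ = ≡.trans (≡.cong (p ^_) (≡.sym k+e≡n)) (≡.trans (^-distribˡ-+-* p k e) (*-comm (p ^ k) (p ^ e)))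

        f : ℕ
        f = m ∸ n

        m≡[k+f]+e : m ≡ (k + f) + e
        m≡[k+f]+e = ≡.trans (≡.sym (m+[n∸m]≡n n≤m)) (≡.trans (≡.cong (_+ f) (≡.sym k+e≡n)) (swap k e f))
          where
          swap : ∀ k e f → k + e + f ≡ k + f + e
          swap = solve-∀

        u⁻¹ : ∃ λ v → u * v ≡ 1 mod p ^ n
        u⁻¹ = coprime⇒mod-inverse (coprime-^ʳ (¬∣⇒coprime p-prime p∤u) n)

        v : ℕ
        v = proj₁ u⁻¹

        uv≡1 : u * v ≡ 1 mod p ^ n
        uv≡1 = proj₂ u⁻¹

        i′ : ℕ
        i′ = i * geometric (r ^ j) v

        X : ℕ
        X = i′ * geometric (r ^ p ^ k) (p ^ e)

      gᵛ≈σⁱ′τᵖᵏ : g ^ℕ v ≈ σ ^ℕ i′ ∙ τ ^ℕ (p ^ k)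
      gᵛ≈σⁱ′τᵖᵏ = trans (g-power v) (∙-congˡ (^ℕ-mod τᴾⁿ≈ε vj≡pᵏ))
        where
        vj≡pᵏ : v * j ≡ p ^ k mod p ^ n
        vj≡pᵏ = ≡.subst₂ (_≡_mod p ^ n) (≡.sym (≡.trans (≡.cong (v *_) j≡pᵏu) (regroup v (p ^ k) u)))
                  (*-identityʳ (p ^ k)) (mod-*-congˡ (p ^ k) uv≡1)
          where
          regroup : ∀ v P u → v * (P * u) ≡ P * (u * v)
          regroup = solve-∀

      [gᵛ]ᴾᵉ≈σˣ : (g ^ℕ v) ^ℕ (p ^ e) ≈ σ ^ℕ X
      [gᵛ]ᴾᵉ≈σˣ = begin
        (g ^ℕ v) ^ℕ (p ^ e)                  ≈⟨ ^ℕ-congˡ (p ^ e) gᵛ≈σⁱ′τᵖᵏ ⟩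
        (σ ^ℕ i′ ∙ τ ^ℕ (p ^ k)) ^ℕ (p ^ e)  ≈⟨ Twisted.twisted-power σ (τ ^ℕ (p ^ k)) (r ^ p ^ k) (twisted-commute (p ^ k)) i′ (p ^ e) ⟩
        σ ^ℕ X ∙ (τ ^ℕ (p ^ k)) ^ℕ (p ^ e)   ≈⟨ ∙-congˡ (^ℕ-assoc τ (p ^ e) (p ^ k)) ⟩
        σ ^ℕ X ∙ τ ^ℕ (p ^ e * p ^ k)        ≡⟨ ≡.cong (λ l → σ ^ℕ X ∙ τ ^ℕ l) pⁿ≡pᵉpᵏ ⟨
        σ ^ℕ X ∙ τ ^ℕ (p ^ n)                ≈⟨ ∙-congˡ τᴾⁿ≈ε ⟩
        σ ^ℕ X ∙ ε                           ≈⟨ identityʳ _ ⟩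
        σ ^ℕ X                               ∎

      [gᵛ]ᴾᵉ≈ε : (g ^ℕ v) ^ℕ (p ^ e) ≈ ε
      [gᵛ]ᴾᵉ≈ε = trans (^ℕ-assoc g (p ^ e) v)
        (⟨g⟩∩⟨σ⟩ (p ^ e * v) X (trans (sym (^ℕ-assoc g (p ^ e) v)) [gᵛ]ᴾᵉ≈σˣ))

      pᵏ∣i′ : p ^ k ∣ i′
      pᵏ∣i′ = ∣-trans (divides (p ^ f) (≡.trans (^-distribˡ-+-* p k f) (*-comm (p ^ k) (p ^ f))))
        (∣*geometric⇒∣ p-prime p-odd (^-≡1 r≡1 (p ^ k)) (k + f) e
          (≡.subst (λ l → p ^ l ∣ X) m≡[k+f]+e (order-∣ σ-order (trans (sym [gᵛ]ᴾᵉ≈σˣ) [gᵛ]ᴾᵉ≈ε))))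

      private
        solution : ∃ λ a → a * geometric r (p ^ k) ≡ i′ mod p ^ m
        solution = ∣⇒≡*geometric p-prime p-odd r≡1 k m pᵏ∣i′

        a : ℕ
        a = proj₁ solution

      τ′ : Carrier
      τ′ = σ ^ℕ a ∙ τ

      τ′ᴾᵏ≈gᵛ : τ′ ^ℕ (p ^ k) ≈ g ^ℕ v
      τ′ᴾᵏ≈gᵛ = begin
        τ′ ^ℕ (p ^ k)                                  ≈⟨ twisted-power a (p ^ k) ⟩
        σ ^ℕ (a * geometric r (p ^ k)) ∙ τ ^ℕ (p ^ k)  ≈⟨ ∙-congʳ (^ℕ-mod σᴾᵐ≈ε (proj₂ solution)) ⟩
        σ ^ℕ i′ ∙ τ ^ℕ (p ^ k)                         ≈⟨ gᵛ≈σⁱ′τᵖᵏ ⟨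
        g ^ℕ v                                         ∎

      τ′-order : HasOrder τ′ (p ^ n)
      τ′-order = twisted-order {a} σ∩τ τ-order (begin
        τ′ ^ℕ (p ^ n)               ≡⟨ ≡.cong (τ′ ^ℕ_) pⁿ≡pᵉpᵏ ⟩
        τ′ ^ℕ (p ^ e * p ^ k)       ≈⟨ ^ℕ-assoc τ′ (p ^ e) (p ^ k) ⟨
        (τ′ ^ℕ (p ^ k)) ^ℕ (p ^ e)  ≈⟨ ^ℕ-congˡ (p ^ e) τ′ᴾᵏ≈gᵛ ⟩
        (g ^ℕ v) ^ℕ (p ^ e)         ≈⟨ [gᵛ]ᴾᵉ≈ε ⟩
        ε                           ∎)

      g∈⟨τ′⟩ : g ∈⟨ τ′ ⟩
      g∈⟨τ′⟩ = + (u * p ^ k) , (begin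
        τ′ ^ℕ (u * p ^ k)     ≈⟨ ^ℕ-assoc τ′ u (p ^ k) ⟨
        (τ′ ^ℕ (p ^ k)) ^ℕ u  ≈⟨ ^ℕ-congˡ u τ′ᴾᵏ≈gᵛ ⟩
        (g ^ℕ v) ^ℕ u         ≈⟨ ^ℕ-assoc g u v ⟩
        g ^ℕ (u * v)          ≈⟨ ^ℕ-mod gᴾⁿ≈ε uv≡1 ⟩
        g ^ℕ 1                ≈⟨ identityʳ g ⟩
        g                     ∎)

    cyclic-complement-through : ∃ λ τ′ → HasOrder τ′ (p ^ n) × g ∈⟨ τ′ ⟩
    cyclic-complement-through = from-split (p-adic-split (prime⇒1<p p-prime) j 0<j)
      where
      from-split : (∃₂ λ k u → j ≡ p ^ k * u × ¬ p ∣ u) → ∃ λ τ′ → HasOrder τ′ (p ^ n) × g ∈⟨ τ′ ⟩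
      from-split (k , u , j≡pᵏu , p∤u) = τ′ , τ′-order , g∈⟨τ′⟩
        where open Split {k} {u} {n ∸ k} j≡pᵏu p∤u (m+[n∸m]≡n (<⇒≤ (k<n {k} {u} j≡pᵏu)))

lemma3p4 : ∀ {c ℓ : Level} (G : Group c ℓ) (p m n : ℕ) → Prime p → ¬ (2 ∣ p) → n ≤ m → 1 ≤ n →
    (σ τ : Group.Carrier G) →
    GroupDefs.HasOrder G σ (p ^ m) → GroupDefs.HasOrder G τ (p ^ n) →
    GroupDefs.NormalCyclic G σ → GroupDefs.TrivialIntersection G σ τ → GroupDefs.Generates G σ τ →
    (g : Group.Carrier G) → ¬ (Group._≈_ G g (Group.ε G)) → GroupDefs.TrivialIntersection G g σ →
    ∃ λ (τ′ : Group.Carrier G) → GroupDefs.HasOrder G τ′ (p ^ n) × GroupDefs._∈⟨_⟩ G g τ′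
lemma3p4 G p m n p-prime p-odd n≤m 1≤n σ τ σ-order@(0<pᵐ , σᴾᵐ≈ε , _) τ-order@(0<pⁿ , τᴾⁿ≈ε , _)
         σ-normal σ∩τ σ-τ-generate g g≉ε g∩σ =
  cyclic-complement-through p-prime p-odd n≤m r σ-order τ-order twist r≡1 σ∩τ i j g≈σⁱτʲ g≉ε g∩σ
  where
  open Group G using (_≈_; _∙_)
  open GroupDefs G using (_^ℕ_)
  open Powers G
  open CyclicComplement G

  conjugation : ∃ λ r → ∀ a → τ ∙ σ ^ℕ a ≈ σ ^ℕ (a * r) ∙ τ
  conjugation = normal⇒twist σ-normal σᴾᵐ≈ε 0<pᵐ τ

  r : ℕ
  r = proj₁ conjugation

  twist : ∀ a → τ ∙ σ ^ℕ a ≈ σ ^ℕ (a * r) ∙ τ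
  twist = proj₂ conjugation

  r≡1 : r ≡ 1 mod p
  r≡1 = Twisted.twist-exponent≡1 σ τ r twist n p-prime (≤-trans 1≤n n≤m) σ-order τᴾⁿ≈ε

  decomposition : ∃₂ λ i j → g ≈ σ ^ℕ i ∙ τ ^ℕ j
  decomposition = generates⇒^ℕ σ-τ-generate σᴾᵐ≈ε 0<pᵐ τᴾⁿ≈ε 0<pⁿ g

  i j : ℕ
  i = proj₁ decomposition
  j = proj₁ (proj₂ decomposition)

  g≈σⁱτʲ : g ≈ σ ^ℕ i ∙ τ ^ℕ j
  g≈σⁱτʲ = proj₂ (proj₂ decomposition)
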